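{- Let $F(i,j)$, $i,j\in\mathbb{N}$, be the double-recurrence Fibonacci numbers, and let $m\in\mathbb{N}$. Then (i) \[ \sum_{\substack{i,j=0\\ j\le i}}^{m}F(i,j)=\frac{2}{5}\left(mL_{m+3}-L_{m+4}+2F_{m+2}\right)+2; \] (ii) \[ \sum_{i,j=0}^{m}F(i,j)=\frac{4}{5}\left(mL_{m+3}-L_{m+4}+2F_{m+2}\right)-F_{m+2}+5. \]
   Context: The Fibonacci sequence is given by $F_0=0$, $F_1=1$, $F_{n+2}=F_{n+1}+F_n$; the Lucas sequence by $L_0=2$, $L_1=1$, $L_{n+2}=L_{n+1}+L_n$. The double-recurrence Fibonacci numbers are the integers $F(m,n)$, $m,n\in\mathbb{N}=\{0,1,2,\dots\}$, determined by the recurrence $F(m,n)=F(m-1,n-1)+F(m-2,n-2)$ for all $m,n\ge 2$, together with the initial values $F(m,0)=F_m$, $F(m,1)=F_{m+1}$ for all $m\ge 0$, and $F(0,n)=F_n$, $F(1,n)=F_{n+1}$ for all $n\ge 0$. The sum in (i) runs over all pairs $(i,j)$ with $0\le j\le i\le m$; the sum in (ii) over all $(i,j)\in\{0,1,\dots,m\}^2$. -}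

module Defs where

open import Data.Nat using (ℕ; zero; suc; _+_; _≤ᵇ_)
open import Data.Bool using (if_then_else_)

fib : ℕ → ℕ
fib 0 = 0
fib 1 = 1
fib (suc (suc n)) = fib (suc n) + fib n

lucas : ℕ → ℕ
lucas 0 = 2
lucas 1 = 1
lucas (suc (suc n)) = lucas (suc n) + lucas n

-- Double-recurrence Fibonacci numbers F(m,n):
--   F(m,0) = F_m, F(m,1) = F_{m+1}, F(0,n) = F_n, F(1,n) = F_{n+1},
--   F(m,n) = F(m-1,n-1) + F(m-2,n-2) for m,n ≥ 2.
-- (The initial values agree on overlaps: F(0,0)=F(0,0)=0, F(0,1)=F(1,0)=1, F(1,1)=1.)
dfib : ℕ → ℕ → ℕ
dfib m 0 = fib m
dfib m 1 = fib (suc m)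
dfib 0 (suc (suc n)) = fib (suc (suc n))
dfib 1 (suc (suc n)) = fib (suc (suc (suc n)))
dfib (suc (suc m)) (suc (suc n)) = dfib (suc m) (suc n) + dfib m n

sumTo : ℕ → (ℕ → ℕ) → ℕ
sumTo zero f = f 0
sumTo (suc m) f = sumTo m f + f (suc m)

triSum : ℕ → ℕ
triSum m = sumTo m (λ i → sumTo i (λ j → dfib i j))

sqSum : ℕ → ℕ
sqSum m = sumTo m (λ i → sumTo m (λ j → dfib i j))

{-# OPTIONS --safe #-}
-- The row sums R(n) = Σ_{j≤n} F(n,j) satisfy
-- R(n+2) = 2F_{n+2} + R(n+1) + R(n), since F(n+2,j+2) = F(n+1,j+1) + F(n,j);
-- with 5F_{n+1} = L_n + L_{n+2} this gives 5R(n) = 2nL_{n+1} + 4F_n, and summing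
-- over the rows gives (i). As F is symmetric with F(n,n) = F_n, the square counts
-- the triangle twice except for its diagonal Σ_{i≤m} F_i = F_{m+2} - 1, which gives (ii).
module Submission where

open import Defs
open import Data.Nat using (ℕ)
open import Relation.Binary.PropositionalEquality
  using (_≡_; refl; sym; trans; cong; cong₂; module ≡-Reasoning)

module RowSums where
  open import Data.Nat using (zero; suc; _+_; _*_)
  open import Data.Nat.Properties using (+-assoc; *-distribˡ-+; +-commutativeSemigroup)
  open import Algebra.Properties.CommutativeSemigroup +-commutativeSemigroup
    using (interchange; x∙yz≈xz∙y; xy∙z≈xz∙y)
  open import Data.Nat.Tactic.RingSolver using (solve-∀)

  open ≡-Reasoning

  sumTo-cong : ∀ n {f g : ℕ → ℕ} → (∀ i → f i ≡ g i) → sumTo n f ≡ sumTo n g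
  sumTo-cong zero    f≡g = f≡g 0
  sumTo-cong (suc n) f≡g = cong₂ _+_ (sumTo-cong n f≡g) (f≡g (suc n))

  sumTo-distrib-+ : ∀ n (f g : ℕ → ℕ) → sumTo n (λ i → f i + g i) ≡ sumTo n f + sumTo n g
  sumTo-distrib-+ zero    f g = refl
  sumTo-distrib-+ (suc n) f g =
    trans (cong (_+ (f (suc n) + g (suc n))) (sumTo-distrib-+ n f g))
          (interchange (sumTo n f) (sumTo n g) (f (suc n)) (g (suc n)))

  sumTo-head : ∀ n (f : ℕ → ℕ) → sumTo (suc n) f ≡ f 0 + sumTo n (λ i → f (suc i))
  sumTo-head zero    f = refl
  sumTo-head (suc n) f =
    trans (cong (_+ f (2 + n)) (sumTo-head n f)) (+-assoc (f 0) _ _)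

  5*fib≡lucas+lucas : ∀ n → 5 * fib (suc n) ≡ lucas n + lucas (2 + n)
  5*fib≡lucas+lucas zero          = refl
  5*fib≡lucas+lucas (suc zero)    = refl
  5*fib≡lucas+lucas (suc (suc n)) = begin
    5 * (fib (2 + n) + fib (suc n))
      ≡⟨ *-distribˡ-+ 5 (fib (2 + n)) (fib (suc n)) ⟩
    5 * fib (2 + n) + 5 * fib (suc n)
      ≡⟨ cong₂ _+_ (5*fib≡lucas+lucas (suc n)) (5*fib≡lucas+lucas n) ⟩
    lucas (suc n) + lucas (3 + n) + (lucas n + lucas (2 + n))
      ≡⟨ interchange (lucas (suc n)) (lucas (3 + n)) (lucas n) (lucas (2 + n)) ⟩
    lucas (suc n) + lucas n + (lucas (3 + n) + lucas (2 + n)) ∎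

  dfib-zeroˡ : ∀ n → dfib 0 n ≡ fib n
  dfib-zeroˡ zero          = refl
  dfib-zeroˡ (suc zero)    = refl
  dfib-zeroˡ (suc (suc n)) = refl

  dfib-oneˡ : ∀ n → dfib 1 n ≡ fib (suc n)
  dfib-oneˡ zero          = refl
  dfib-oneˡ (suc zero)    = refl
  dfib-oneˡ (suc (suc n)) = refl

  dfib-comm : ∀ m n → dfib m n ≡ dfib n m
  dfib-comm m             zero          = sym (dfib-zeroˡ m)
  dfib-comm m             (suc zero)    = sym (dfib-oneˡ m)
  dfib-comm zero          (suc (suc n)) = refl
  dfib-comm (suc zero)    (suc (suc n)) = refl
  dfib-comm (suc (suc m)) (suc (suc n)) = cong₂ _+_ (dfib-comm (suc m) (suc n)) (dfib-comm m n)

  dfib-diagonal : ∀ n → dfib n n ≡ fib n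
  dfib-diagonal zero          = refl
  dfib-diagonal (suc zero)    = refl
  dfib-diagonal (suc (suc n)) = cong₂ _+_ (dfib-diagonal (suc n)) (dfib-diagonal n)

  rowSum : ℕ → ℕ
  rowSum m = sumTo m (dfib m)

  rowSum-rec : ∀ n → rowSum (2 + n) ≡ 2 * fib (2 + n) + rowSum (suc n) + rowSum n
  rowSum-rec n = begin
    rowSum (2 + n)
      ≡⟨ sumTo-head (suc n) (dfib (2 + n)) ⟩
    fib (2 + n) + sumTo (suc n) (λ j → dfib (2 + n) (suc j))
      ≡⟨ cong (fib (2 + n) +_) (sumTo-head n _) ⟩
    fib (2 + n) + (fib (3 + n) + sumTo n (λ j → dfib (suc n) (suc j) + dfib n j))
      ≡⟨ cong (λ s → fib (2 + n) + (fib (3 + n) + s)) (sumTo-distrib-+ n _ _) ⟩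
    fib (2 + n) + (fib (3 + n) + (tail + rowSum n))
      ≡⟨ regroup (fib (2 + n)) (fib (suc n)) tail (rowSum n) ⟩
    2 * fib (2 + n) + (fib (suc n) + tail) + rowSum n
      ≡⟨ cong (λ s → 2 * fib (2 + n) + s + rowSum n) (sym (sumTo-head n (dfib (suc n)))) ⟩
    2 * fib (2 + n) + rowSum (suc n) + rowSum n ∎
    where
    tail : ℕ
    tail = sumTo n (λ j → dfib (suc n) (suc j))
    regroup : ∀ a b c d → a + ((a + b) + (c + d)) ≡ 2 * a + (b + c) + d
    regroup = solve-∀

  5*rowSum : ∀ n → 5 * rowSum n ≡ 2 * n * lucas (suc n) + 4 * fib n
  5*rowSum zero          = refl
  5*rowSum (suc zero)    = refl
  5*rowSum (suc (suc n)) = begin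
    5 * rowSum (2 + n)
      ≡⟨ cong (5 *_) (rowSum-rec n) ⟩
    5 * (2 * fib (2 + n) + rowSum (suc n) + rowSum n)
      ≡⟨ distribute (fib (2 + n)) (rowSum (suc n)) (rowSum n) ⟩
    2 * (5 * fib (2 + n)) + 5 * rowSum (suc n) + 5 * rowSum n
      ≡⟨ cong₂ _+_ (cong₂ (λ a b → 2 * a + b) (5*fib≡lucas+lucas (suc n)) (5*rowSum (suc n)))
                   (5*rowSum n) ⟩
    2 * (lucas (suc n) + lucas (3 + n)) + (2 * suc n * lucas (2 + n) + 4 * fib (suc n))
      + (2 * n * lucas (suc n) + 4 * fib n)
      ≡⟨ collect n (lucas (suc n)) (lucas (2 + n)) (fib n) (fib (suc n)) ⟩
    2 * (2 + n) * lucas (3 + n) + 4 * fib (2 + n) ∎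
    where
    distribute : ∀ f r s → 5 * (2 * f + r + s) ≡ 2 * (5 * f) + 5 * r + 5 * s
    distribute = solve-∀
    collect : ∀ n l₁ l₂ f₀ f₁ →
      2 * (l₁ + (l₂ + l₁)) + (2 * suc n * l₂ + 4 * f₁) + (2 * n * l₁ + 4 * f₀)
        ≡ 2 * (2 + n) * (l₂ + l₁) + 4 * (f₁ + f₀)
    collect = solve-∀

  -- (i) with the subtracted term moved to the left, so that no truncated subtraction occurs.
  5*triSum : ∀ m → 5 * triSum m + 2 * lucas (4 + m) ≡ 2 * m * lucas (3 + m) + 4 * fib (2 + m) + 10
  5*triSum zero    = refl
  5*triSum (suc m) = begin
    5 * (triSum m + rowSum (suc m)) + 2 * (lucas (4 + m) + lucas (3 + m))
      ≡⟨ regroup (triSum m) (rowSum (suc m)) (lucas (4 + m)) (lucas (3 + m)) ⟩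
    (5 * triSum m + 2 * lucas (4 + m)) + 5 * rowSum (suc m) + 2 * lucas (3 + m)
      ≡⟨ cong₂ (λ a b → a + b + 2 * lucas (3 + m)) (5*triSum m) (5*rowSum (suc m)) ⟩
    2 * m * lucas (3 + m) + 4 * fib (2 + m) + 10 + (2 * suc m * lucas (2 + m) + 4 * fib (suc m))
      + 2 * lucas (3 + m)
      ≡⟨ collect m (lucas (2 + m)) (lucas (3 + m)) (fib (suc m)) (fib (2 + m)) ⟩
    2 * suc m * lucas (4 + m) + 4 * fib (3 + m) + 10 ∎
    where
    regroup : ∀ t r a b → 5 * (t + r) + 2 * (a + b) ≡ (5 * t + 2 * a) + 5 * r + 2 * b
    regroup = solve-∀
    collect : ∀ m l₂ l₃ f₁ f₂ →
      2 * m * l₃ + 4 * f₂ + 10 + (2 * suc m * l₂ + 4 * f₁) + 2 * l₃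
        ≡ 2 * suc m * (l₃ + l₂) + 4 * (f₂ + f₁) + 10
    collect = solve-∀

  sqSum-suc : ∀ m → sqSum (suc m) + fib (suc m) ≡ sqSum m + 2 * rowSum (suc m)
  sqSum-suc m = begin
    sumTo m (λ i → sumTo m (dfib i) + dfib i (suc m)) + rowSum (suc m) + fib (suc m)
      ≡⟨ cong (λ s → s + rowSum (suc m) + fib (suc m)) (sumTo-distrib-+ m _ _) ⟩
    sqSum m + sumTo m (λ i → dfib i (suc m)) + rowSum (suc m) + fib (suc m)
      ≡⟨ cong (λ s → sqSum m + s + rowSum (suc m) + fib (suc m))
              (sumTo-cong m (λ i → dfib-comm i (suc m))) ⟩
    sqSum m + column + rowSum (suc m) + fib (suc m)
      ≡⟨ regroup (sqSum m) column (rowSum (suc m)) (fib (suc m)) ⟩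
    sqSum m + rowSum (suc m) + (column + fib (suc m))
      ≡⟨ cong (λ d → sqSum m + rowSum (suc m) + (column + d)) (sym (dfib-diagonal (suc m))) ⟩
    sqSum m + rowSum (suc m) + rowSum (suc m)
      ≡⟨ double (sqSum m) (rowSum (suc m)) ⟩
    sqSum m + 2 * rowSum (suc m) ∎
    where
    column : ℕ
    column = sumTo m (dfib (suc m))
    regroup : ∀ s c r f → s + c + r + f ≡ s + r + (c + f)
    regroup = solve-∀
    double : ∀ s r → s + r + r ≡ s + 2 * r
    double = solve-∀

  sqSum+fib : ∀ m → sqSum m + fib (2 + m) ≡ 2 * triSum m + 1
  sqSum+fib zero    = refl
  sqSum+fib (suc m) = begin
    sqSum (suc m) + (fib (2 + m) + fib (suc m))
      ≡⟨ x∙yz≈xz∙y (sqSum (suc m)) (fib (2 + m)) (fib (suc m)) ⟩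
    sqSum (suc m) + fib (suc m) + fib (2 + m)
      ≡⟨ cong (_+ fib (2 + m)) (sqSum-suc m) ⟩
    sqSum m + 2 * rowSum (suc m) + fib (2 + m)
      ≡⟨ xy∙z≈xz∙y (sqSum m) (2 * rowSum (suc m)) (fib (2 + m)) ⟩
    sqSum m + fib (2 + m) + 2 * rowSum (suc m)
      ≡⟨ cong (_+ 2 * rowSum (suc m)) (sqSum+fib m) ⟩
    2 * triSum m + 1 + 2 * rowSum (suc m)
      ≡⟨ collect (triSum m) (rowSum (suc m)) ⟩
    2 * (triSum m + rowSum (suc m)) + 1 ∎
    where
    collect : ∀ t r → 2 * t + 1 + 2 * r ≡ 2 * (t + r) + 1
    collect = solve-∀

open RowSums using (5*triSum; sqSum+fib)
import Data.Nat as Nat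
open import Data.Nat.Properties using (+-comm)
open import Data.Integer using (ℤ; +_; _+_; _-_; _*_)
open import Data.Integer.Properties using (pos-+; pos-*)
open import Data.Integer.Tactic.RingSolver using (solve-∀)
open import Data.Product using (_×_; _,_)
open ≡-Reasoning

5*triSum-ℤ : ∀ m → (+ 5) * (+ triSum m) + (+ 2) * (+ lucas (4 Nat.+ m))
                    ≡ (+ 2) * (+ m) * (+ lucas (3 Nat.+ m)) + (+ 4) * (+ fib (2 Nat.+ m)) + (+ 10)
5*triSum-ℤ m = begin
  (+ 5) * (+ t) + (+ 2) * (+ l₄)
    ≡⟨ sym (cong₂ _+_ (pos-* 5 t) (pos-* 2 l₄)) ⟩
  + (5 Nat.* t) + + (2 Nat.* l₄)
    ≡⟨ sym (pos-+ (5 Nat.* t) (2 Nat.* l₄)) ⟩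
  + (5 Nat.* t Nat.+ 2 Nat.* l₄)
    ≡⟨ cong +_ (5*triSum m) ⟩
  + (2 Nat.* m Nat.* l₃ Nat.+ 4 Nat.* f Nat.+ 10)
    ≡⟨ trans (pos-+ _ 10) (cong (_+ (+ 10)) (pos-+ (2 Nat.* m Nat.* l₃) (4 Nat.* f))) ⟩
  + (2 Nat.* m Nat.* l₃) + + (4 Nat.* f) + (+ 10)
    ≡⟨ cong₂ (λ a b → a + b + (+ 10))
             (trans (pos-* (2 Nat.* m) l₃) (cong (_* (+ l₃)) (pos-* 2 m))) (pos-* 4 f) ⟩
  (+ 2) * (+ m) * (+ l₃) + (+ 4) * (+ f) + (+ 10) ∎
  where
  t l₃ l₄ f : ℕ
  t = triSum m
  l₃ = lucas (3 Nat.+ m)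
  l₄ = lucas (4 Nat.+ m)
  f = fib (2 Nat.+ m)

sqSum+fib-ℤ : ∀ m → (+ sqSum m) + (+ fib (2 Nat.+ m)) ≡ (+ 2) * (+ triSum m) + (+ 1)
sqSum+fib-ℤ m = begin
  (+ sqSum m) + (+ fib (2 Nat.+ m))    ≡⟨ sym (pos-+ (sqSum m) (fib (2 Nat.+ m))) ⟩
  + (sqSum m Nat.+ fib (2 Nat.+ m))    ≡⟨ cong +_ (sqSum+fib m) ⟩
  + (2 Nat.* triSum m Nat.+ 1)         ≡⟨ trans (pos-+ _ 1) (cong (_+ (+ 1)) (pos-* 2 (triSum m))) ⟩
  (+ 2) * (+ triSum m) + (+ 1) ∎

closed-forms : ∀ (m t s l₃ l₄ f : ℤ) →
  (+ 5) * t + (+ 2) * l₄ ≡ (+ 2) * m * l₃ + (+ 4) * f + (+ 10) →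
  s + f ≡ (+ 2) * t + (+ 1) →
  ((+ 5) * t ≡ (+ 2) * (m * l₃ - l₄ + (+ 2) * f) + (+ 10))
    × ((+ 5) * s ≡ (+ 4) * (m * l₃ - l₄ + (+ 2) * f) - (+ 5) * f + (+ 25))
closed-forms m t s l₃ l₄ f triangle square = first , second
  where
  first : (+ 5) * t ≡ (+ 2) * (m * l₃ - l₄ + (+ 2) * f) + (+ 10)
  first = begin
    (+ 5) * t                                          ≡⟨ add-sub t l₄ ⟩
    ((+ 5) * t + (+ 2) * l₄) - (+ 2) * l₄              ≡⟨ cong (_- (+ 2) * l₄) triangle ⟩
    (+ 2) * m * l₃ + (+ 4) * f + (+ 10) - (+ 2) * l₄   ≡⟨ collect₁ m l₃ l₄ f ⟩
    (+ 2) * (m * l₃ - l₄ + (+ 2) * f) + (+ 10) ∎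
    where
    add-sub : ∀ t l₄ → (+ 5) * t ≡ ((+ 5) * t + (+ 2) * l₄) - (+ 2) * l₄
    add-sub = solve-∀
    collect₁ : ∀ m l₃ l₄ f → (+ 2) * m * l₃ + (+ 4) * f + (+ 10) - (+ 2) * l₄
                             ≡ (+ 2) * (m * l₃ - l₄ + (+ 2) * f) + (+ 10)
    collect₁ = solve-∀
  second : (+ 5) * s ≡ (+ 4) * (m * l₃ - l₄ + (+ 2) * f) - (+ 5) * f + (+ 25)
  second = begin
    (+ 5) * s                                          ≡⟨ add-sub s f ⟩
    (+ 5) * (s + f) - (+ 5) * f                        ≡⟨ cong (λ x → (+ 5) * x - (+ 5) * f) square ⟩
    (+ 5) * ((+ 2) * t + (+ 1)) - (+ 5) * f            ≡⟨ expand t f ⟩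
    (+ 2) * ((+ 5) * t) + (+ 5) - (+ 5) * f            ≡⟨ cong (λ x → (+ 2) * x + (+ 5) - (+ 5) * f) first ⟩
    (+ 2) * ((+ 2) * e + (+ 10)) + (+ 5) - (+ 5) * f   ≡⟨ collect₂ e f ⟩
    (+ 4) * e - (+ 5) * f + (+ 25) ∎
    where
    e : ℤ
    e = m * l₃ - l₄ + (+ 2) * f
    add-sub : ∀ s f → (+ 5) * s ≡ (+ 5) * (s + f) - (+ 5) * f
    add-sub = solve-∀
    expand : ∀ t f → (+ 5) * ((+ 2) * t + (+ 1)) - (+ 5) * f ≡ (+ 2) * ((+ 5) * t) + (+ 5) - (+ 5) * f
    expand = solve-∀
    collect₂ : ∀ e f → (+ 2) * ((+ 2) * e + (+ 10)) + (+ 5) - (+ 5) * f ≡ (+ 4) * e - (+ 5) * f + (+ 25)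
    collect₂ = solve-∀

proposition7 : (m : ℕ) →
    ((+ 5) * (+ triSum m)
      ≡ (+ 2) * ((+ m) * (+ lucas (m Data.Nat.+ 3)) - (+ lucas (m Data.Nat.+ 4)) + (+ 2) * (+ fib (m Data.Nat.+ 2))) + (+ 10))
    × ((+ 5) * (+ sqSum m)
      ≡ (+ 4) * ((+ m) * (+ lucas (m Data.Nat.+ 3)) - (+ lucas (m Data.Nat.+ 4)) + (+ 2) * (+ fib (m Data.Nat.+ 2))) - (+ 5) * (+ fib (m Data.Nat.+ 2)) + (+ 25))
proposition7 m rewrite +-comm m 3 | +-comm m 4 | +-comm m 2 =
  closed-forms (+ m) (+ triSum m) (+ sqSum m)
    (+ lucas (3 Nat.+ m)) (+ lucas (4 Nat.+ m)) (+ fib (2 Nat.+ m))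
    (5*triSum-ℤ m) (sqSum+fib-ℤ m)
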